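{- Let $d \geq 0$ be an even integer. Then the graph $G_4(d)$ has exactly one maximum independent set, i.e. $\mathrm{a}_4(d) = 1$.
   Context: For integers $n \geq 1$ and $d \geq 0$, let $S_n(d)$ be the set of monomials of degree $d$ in the polynomial ring $\mathbb{F}[x_1,\dots,x_n]$ over a field $\mathbb{F}$. The graph $G_n(d)$ has vertex set $S_n(d)$, and two monomials $f,g \in S_n(d)$ are adjacent if and only if $\mathrm{lcm}(f,g)$ has degree $d+1$. A maximum independent set is an independent set of largest possible size, and $\mathrm{a}_n(d)$ denotes the number of maximum independent sets of $G_n(d)$. -}

module Defs where

open import Data.Nat using (ℕ; suc; _⊔_; _≤_)
open import Data.Vec using (Vec; sum; zipWith)
open import Data.Product using (Σ; _×_; proj₁)
open import Data.List using (List; length)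
open import Data.List.Membership.Propositional using (_∈_)
open import Data.List.Relation.Unary.Unique.Propositional using (Unique)
open import Relation.Binary.PropositionalEquality using (_≡_)
open import Relation.Nullary using (¬_)

-- A monomial in x_1..x_n is represented by its exponent vector; its degree is the sum.
-- (The field F plays no role in the graph G_n(d).)
Monomial : ℕ → Set
Monomial n = Vec ℕ n

deg : ∀ {n} → Monomial n → ℕ
deg = sum

lcm : ∀ {n} → Monomial n → Monomial n → Monomial n
lcm = zipWith _⊔_

S : ℕ → ℕ → Set
S n d = Σ (Monomial n) (λ f → deg f ≡ d)

Adj : ∀ {n d} → S n d → S n d → Set
Adj {n} {d} f g = deg (lcm (proj₁ f) (proj₁ g)) ≡ suc d

IndependentSet : (n d : ℕ) → List (S n d) → Set
IndependentSet n d I =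
  Unique I × (∀ {f g} → f ∈ I → g ∈ I → ¬ Adj f g)

MaximumIndependentSet : (n d : ℕ) → List (S n d) → Set
MaximumIndependentSet n d I =
  IndependentSet n d I ×
  (∀ (J : List (S n d)) → IndependentSet n d J → length J ≤ length I)

SameSet : ∀ {A : Set} → List A → List A → Set
SameSet {A} I J = ∀ (x : A) → (x ∈ I → x ∈ J) × (x ∈ J → x ∈ I)

-- Call a monomial pure when all its exponents have the same parity. Pure monomials of one
-- degree d are never adjacent: if their parities agree, the lcm has degree of the parity of d,
-- not d + 1; if not, every exponent of the lcm exceeds the mean of the two exponents by at
-- least 1/2, so with four variables the lcm has degree at least d + 2.
--
-- Conversely, for even d every vertex x lies in one of the cliques {v·xⱼ/xᵢ}ⱼ or {v·xₜ/xᵢ}ᵢ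
-- attached to a pure vertex v. On the slab x₄ ≤ 1 the clique of v is chosen according to
-- whether one of its halved first three exponents exceeds the sum of the other two, and the
-- choice is transported to all vertices by multiplication with x₄². Vertices attached to the
-- same v are equal or adjacent, so every independent set injects into the pure vertices.
--
-- Let J be independent and at least as large as the pure set.
-- The same injection restricted to the slab shows that the vertices of J divisible by x₄²,
-- divided by x₄², form an independent set of degree d − 2 at least as large as its pure set,
-- so they are pure; by symmetry so is every vertex of J with an exponent ≥ 2. Of the remaining
-- vertices x₁x₂x₃x₄ is pure, and in degree 2 a vertex xᵢxⱼ would be adjacent to xᵢ², which lies
-- in J by the previous step.

module Submission where

open import Defs
open import Data.Nat using (ℕ; _*_)
open import Data.Product using (Σ; _×_)
open import Data.List using (List)
open import Relation.Binary.PropositionalEquality using (_≡_)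

open import Data.Nat using (zero; suc; _+_; _≤_; _<_; _⊔_; z≤n; s≤s; _≤?_; _<?_; ⌊_/2⌋; parity)
import Data.Nat as ℕ
open import Data.Nat.Properties
open import Data.Nat.Tactic.RingSolver using (solve-∀)
open import Data.Parity.Base as ℙ using (Parity; 0ℙ; 1ℙ; _⁻¹)
open import Data.Parity.Properties using (+-homo-+; suc-homo-⁻¹; p≢p⁻¹) renaming (_≟_ to _≟ℙ_)
open import Data.Fin using (Fin; zero; suc; #_; inject₁)
import Data.Fin.Properties as Fin
open import Data.Vec using ([]; _∷_; updateAt; lookup; replicate)
import Data.Vec.Properties as Vec
import Data.Vec.Relation.Unary.All as V
open import Data.Vec.Relation.Unary.All using ([]; _∷_)
open import Data.List using ([]; _∷_; _++_; length; map; filter; upTo; cartesianProductWith)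
open import Data.List.Properties using (length-map; length-++-sucʳ; filter-accept; filter-reject)
open import Data.List.Membership.Propositional using (_∈_; _∉_)
open import Data.List.Membership.Propositional.Properties
  using (∈-∃++; ∈-++⁻; ∈-++⁺ˡ; ∈-++⁺ʳ; ∈-map⁺; ∈-map⁻; ∈-filter⁺; ∈-filter⁻; ∈-cartesianProductWith⁺; ∈-upTo⁺)
import Data.List.Membership.DecPropositional as DecMembership
open import Data.List.Relation.Binary.Subset.Propositional using (_⊆_)
open import Data.List.Relation.Unary.Any using (here; there)
import Data.List.Relation.Unary.All as All
open import Data.List.Relation.Unary.All.Properties using (All¬⇒¬Any) renaming (map⁺ to All-map⁺)
open import Data.List.Relation.Unary.AllPairs using ([]; _∷_)
open import Data.List.Relation.Unary.Unique.Propositional using (Unique)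
import Data.List.Relation.Unary.Unique.Propositional.Properties as Unique
open import Data.Product using (_,_; proj₁; proj₂; ∃-syntax)
open import Data.Sum as Sum using (_⊎_; inj₁; inj₂)
open import Data.Empty using (⊥; ⊥-elim)
open import Function using (_∘_)
open import Relation.Binary.Definitions using (DecidableEquality; tri<; tri≈; tri>)
open import Relation.Binary.PropositionalEquality
  using (refl; sym; trans; cong; cong₂; subst; subst₂; _≢_; module ≡-Reasoning)
open import Relation.Nullary using (¬_; Dec; yes; no; contradiction)
open import Relation.Nullary.Decidable using (map′)
open import Relation.Unary using (Decidable)

module _ {A : Set} where

  ⊆-delete : ∀ {v : A} {xs} ys zs → v ∉ xs → xs ⊆ ys ++ v ∷ zs → xs ⊆ ys ++ zs
  ⊆-delete ys zs v∉xs xs⊆ x∈xs with ∈-++⁻ ys (xs⊆ x∈xs)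
  ... | inj₁ x∈ys         = ∈-++⁺ˡ x∈ys
  ... | inj₂ (here refl)  = contradiction x∈xs v∉xs
  ... | inj₂ (there x∈zs) = ∈-++⁺ʳ ys x∈zs

  Unique-⊆⇒length≤ : ∀ {xs ys : List A} → Unique xs → xs ⊆ ys → length xs ≤ length ys
  Unique-⊆⇒length≤ {[]}     _          _      = z≤n
  Unique-⊆⇒length≤ {x ∷ xs} (x∉xs ∷ u) x∷xs⊆ with ∈-∃++ (x∷xs⊆ (here refl))
  ... | ys , zs , refl = begin
    suc (length xs)         ≤⟨ s≤s (Unique-⊆⇒length≤ u xs⊆) ⟩
    suc (length (ys ++ zs)) ≡⟨ length-++-sucʳ ys x zs ⟨
    length (ys ++ x ∷ zs)   ∎
    where
    open ≤-Reasoning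
    xs⊆ : xs ⊆ ys ++ zs
    xs⊆ = ⊆-delete ys zs (All¬⇒¬Any x∉xs) (λ y∈xs → x∷xs⊆ (there y∈xs))

  Unique-⊆-length≥⇒⊇ : DecidableEquality A → ∀ {xs ys : List A} →
    Unique ys → ys ⊆ xs → length xs ≤ length ys → xs ⊆ ys
  Unique-⊆-length≥⇒⊇ _≟_ {ys = ys} u ys⊆xs xs≤ys {v} v∈xs with DecMembership._∈?_ _≟_ v ys
  ... | yes v∈ys = v∈ys
  ... | no v∉ys with ∈-∃++ v∈xs
  ... | as , bs , refl = contradiction xs≤ys (<⇒≱ (begin-strict
    length ys              ≤⟨ Unique-⊆⇒length≤ u (⊆-delete as bs v∉ys ys⊆xs) ⟩
    length (as ++ bs)      <⟨ n<1+n _ ⟩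
    suc (length (as ++ bs)) ≡⟨ length-++-sucʳ as v bs ⟨
    length (as ++ v ∷ bs)  ∎))
    where open ≤-Reasoning

  Unique-map⁺ : ∀ {B : Set} {f : A → B} {xs : List A} →
    (∀ {x y} → x ∈ xs → y ∈ xs → f x ≡ f y → x ≡ y) → Unique xs → Unique (map f xs)
  Unique-map⁺ {xs = []}     _   []         = []
  Unique-map⁺ {xs = x ∷ xs} inj (x∉xs ∷ u) =
    All-map⁺ (All.tabulate λ y∈xs fx≡fy → All.lookup x∉xs y∈xs (inj (here refl) (there y∈xs) fx≡fy))
    ∷ Unique-map⁺ (λ x∈ y∈ → inj (there x∈) (there y∈)) u

  ∈⇒0<length : ∀ {x : A} {xs} → x ∈ xs → 0 < length xs
  ∈⇒0<length (here _)  = s≤s z≤n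
  ∈⇒0<length (there _) = s≤s z≤n

  0<length⇒∈ : ∀ (xs : List A) → 0 < length xs → ∃[ x ] x ∈ xs
  0<length⇒∈ (x ∷ _) _ = x , here refl

S-≡ : ∀ {n d} {f g : S n d} → proj₁ f ≡ proj₁ g → f ≡ g
S-≡ {f = x , p} {g = .x , q} refl = cong (x ,_) (≡-irrelevant p q)

_≟S_ : ∀ {n d} → DecidableEquality (S n d)
f ≟S g = map′ S-≡ (cong proj₁) (Vec.≡-dec ℕ._≟_ (proj₁ f) (proj₁ g))

module _ {n d : ℕ} where

  Near : S n d → S n d → Set
  Near f g = f ≡ g ⊎ Adj f g

  filter-independent : ∀ {P : S n d → Set} (P? : Decidable P) {J} →
    IndependentSet n d J → IndependentSet n d (filter P? J)
  filter-independent P? {J} (u , ind) = Unique.filter⁺ P? u , λ f∈ g∈ →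
    ind (proj₁ (∈-filter⁻ P? {xs = J} f∈)) (proj₁ (∈-filter⁻ P? {xs = J} g∈))

  map-independent : ∀ (φ : S n d → S n d) → (∀ f → φ (φ f) ≡ f) → (∀ {f g} → Adj (φ f) (φ g) → Adj f g) →
    ∀ {J} → IndependentSet n d J → IndependentSet n d (map φ J)
  map-independent φ φ-involutive φ-reflects-Adj (u , ind) =
    Unique-map⁺ (λ _ _ φf≡φg → trans (sym (φ-involutive _)) (trans (cong φ φf≡φg) (φ-involutive _))) u ,
    independent
    where
    independent : ∀ {f′ g′} → f′ ∈ map φ _ → g′ ∈ map φ _ → ¬ Adj f′ g′
    independent φf∈ φg∈ with ∈-map⁻ φ φf∈ | ∈-map⁻ φ φg∈
    ... | f , f∈ , refl | g , g∈ , refl = ind f∈ g∈ ∘ φ-reflects-Adj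

  cliqueCover-length≤ : ∀ {I J} (label : S n d → S n d) →
    (∀ {f g} → label f ≡ label g → Near f g) →
    IndependentSet n d J → (∀ {f} → f ∈ J → label f ∈ I) → length J ≤ length I
  cliqueCover-length≤ {I} {J} label near (u , ind) label∈I = begin
    length J             ≡⟨ length-map label J ⟨
    length (map label J) ≤⟨ Unique-⊆⇒length≤ (Unique-map⁺ injective u) image⊆I ⟩
    length I             ∎
    where
    open ≤-Reasoning
    injective : ∀ {f g} → f ∈ J → g ∈ J → label f ≡ label g → f ≡ g
    injective f∈ g∈ eq with near eq
    ... | inj₁ f≡g = f≡g
    ... | inj₂ adj = contradiction adj (ind f∈ g∈)
    image⊆I : map label J ⊆ I
    image⊆I z∈ with ∈-map⁻ label z∈
    ... | f , f∈ , refl = label∈I f∈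

  uniqueMaximum : ∀ {I} → IndependentSet n d I →
    (∀ J → IndependentSet n d J → length J ≤ length I) →
    (∀ J → IndependentSet n d J → length I ≤ length J → J ⊆ I) →
    MaximumIndependentSet n d I × (∀ J → MaximumIndependentSet n d J → SameSet J I)
  uniqueMaximum {I} indI bound large⊆I = (indI , bound) , sameSet
    where
    sameSet : ∀ J → MaximumIndependentSet n d J → SameSet J I
    sameSet J (indJ , maxJ) f = J⊆I , Unique-⊆-length≥⇒⊇ _≟S_ (proj₁ indJ) J⊆I (maxJ I indI)
      where
      J⊆I : J ⊆ I
      J⊆I = large⊆I J indJ (maxJ I indI)

mulVar : ∀ {n} → Fin n → Monomial n → Monomial n
mulVar i x = updateAt x i suc

deg-mulVar : ∀ {n} i (x : Monomial n) → deg (mulVar i x) ≡ suc (deg x)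
deg-mulVar zero    (a ∷ x) = refl
deg-mulVar (suc i) (a ∷ x) = trans (cong (a +_) (deg-mulVar i x)) (+-suc a (deg x))

mulVar-injective : ∀ {n} i {x y : Monomial n} → mulVar i x ≡ mulVar i y → x ≡ y
mulVar-injective zero    {a ∷ x} {.a ∷ .x} refl = refl
mulVar-injective (suc i) {a ∷ x} {b ∷ y} eq with Vec.∷-injective eq
... | refl , eq′ = cong (a ∷_) (mulVar-injective i eq′)

mulVar-comm : ∀ {n} i j (x : Monomial n) → mulVar i (mulVar j x) ≡ mulVar j (mulVar i x)
mulVar-comm zero    zero    x       = refl
mulVar-comm zero    (suc j) (a ∷ x) = refl
mulVar-comm (suc i) zero    (a ∷ x) = refl
mulVar-comm (suc i) (suc j) (a ∷ x) = cong (a ∷_) (mulVar-comm i j x)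

lcm-idem : ∀ {n} (x : Monomial n) → lcm x x ≡ x
lcm-idem = Vec.zipWith-idem ⊔-idem

lcm-comm : ∀ {n} (x y : Monomial n) → lcm x y ≡ lcm y x
lcm-comm = Vec.zipWith-comm ⊔-comm

lcm-mulVarˡ : ∀ {n} i (x : Monomial n) → lcm (mulVar i x) x ≡ mulVar i x
lcm-mulVarˡ zero    (a ∷ x) = cong₂ _∷_ (m≥n⇒m⊔n≡m (n≤1+n a)) (lcm-idem x)
lcm-mulVarˡ (suc i) (a ∷ x) = cong₂ _∷_ (⊔-idem a) (lcm-mulVarˡ i x)

lcm-mulVarʳ : ∀ {n} i (x : Monomial n) → lcm x (mulVar i x) ≡ mulVar i x
lcm-mulVarʳ i x = trans (lcm-comm x (mulVar i x)) (lcm-mulVarˡ i x)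

lcm-mulVar : ∀ {n} {i j} {x y : Monomial n} → i ≢ j → mulVar i x ≡ mulVar j y → lcm x y ≡ mulVar i x
lcm-mulVar {i = zero}  {zero}            i≢j _    = contradiction refl i≢j
lcm-mulVar {i = zero}  {suc j} {a ∷ _} {_ ∷ y} _ refl =
  cong₂ _∷_ (m≤n⇒m⊔n≡n (n≤1+n a)) (lcm-mulVarˡ j y)
lcm-mulVar {i = suc i} {zero}  {_ ∷ x} {b ∷ _} _ refl =
  cong₂ _∷_ (m≥n⇒m⊔n≡m (n≤1+n b)) (lcm-mulVarʳ i x)
lcm-mulVar {i = suc i} {suc j} {a ∷ _} {_ ∷ _} i≢j eq with Vec.∷-injective eq
... | refl , eq′ = cong₂ _∷_ (⊔-idem a) (lcm-mulVar (i≢j ∘ cong suc) eq′)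

Adjacent : ∀ {n} → Monomial n → Monomial n → Set
Adjacent x y = deg (lcm x y) ≡ suc (deg x)

mulVar-adjacent : ∀ {n} {i j} {x y : Monomial n} → i ≢ j → mulVar i x ≡ mulVar j y → Adjacent x y
mulVar-adjacent {i = i} {x = x} i≢j eq = trans (cong deg (lcm-mulVar i≢j eq)) (deg-mulVar i x)

mulVar-near : ∀ {n} i j {x y : Monomial n} → mulVar i x ≡ mulVar j y → x ≡ y ⊎ Adjacent x y
mulVar-near i j eq with i Fin.≟ j
... | yes refl = inj₁ (mulVar-injective i eq)
... | no i≢j   = inj₂ (mulVar-adjacent i≢j eq)

-- down i v is the clique {v·xⱼ/xᵢ} of the multiples of v/xᵢ, and up t v is the clique
-- {v·xₜ/xᵢ} of the divisors of v·xₜ.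
data CliqueType (n : ℕ) : Set where
  down up : Fin n → CliqueType n

InClique : ∀ {n} → CliqueType n → Monomial n → Monomial n → Set
InClique (down i) v x = ∃[ j ] mulVar i x ≡ mulVar j v
InClique (up t)   v x = ∃[ i ] mulVar i x ≡ mulVar t v

InClique-refl : ∀ {n} (c : CliqueType n) v → InClique c v v
InClique-refl (down i) v = i , refl
InClique-refl (up t)   v = t , refl

mulVar-InClique : ∀ {n} {c : CliqueType n} {v x i t} → mulVar i x ≡ mulVar t v →
  c ≡ down i ⊎ c ≡ up t → InClique c v x
mulVar-InClique eq (inj₁ refl) = _ , eq
mulVar-InClique eq (inj₂ refl) = _ , eq

InClique-near : ∀ {n} (c : CliqueType n) v {x y} → InClique c v x → InClique c v y → x ≡ y ⊎ Adjacent x y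
InClique-near (up t)   v (i , x∈) (i′ , y∈) = mulVar-near i i′ (trans x∈ (sym y∈))
InClique-near (down i) v {x} {y} (j , x∈) (j′ , y∈) = mulVar-near j′ j (mulVar-injective i (begin
  mulVar i (mulVar j′ x) ≡⟨ mulVar-comm i j′ x ⟩
  mulVar j′ (mulVar i x) ≡⟨ cong (mulVar j′) x∈ ⟩
  mulVar j′ (mulVar j v) ≡⟨ mulVar-comm j′ j v ⟩
  mulVar j (mulVar j′ v) ≡⟨ cong (mulVar j) y∈ ⟨
  mulVar j (mulVar i y)  ≡⟨ mulVar-comm j i y ⟩
  mulVar i (mulVar j y)  ∎))
  where open ≡-Reasoning

mulVar-deg : ∀ {n} i j {x y : Monomial n} → mulVar i x ≡ mulVar j y → deg x ≡ deg y
mulVar-deg i j {x} {y} eq = suc-injective (begin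
  suc (deg x)       ≡⟨ deg-mulVar i x ⟨
  deg (mulVar i x)  ≡⟨ cong deg eq ⟩
  deg (mulVar j y)  ≡⟨ deg-mulVar j y ⟩
  suc (deg y)       ∎)
  where open ≡-Reasoning

deg-InClique : ∀ {n} (c : CliqueType n) v {x} → InClique c v x → deg x ≡ deg v
deg-InClique (down i) v (j , eq) = mulVar-deg i j eq
deg-InClique (up t)   v (i , eq) = mulVar-deg i t eq

lcm-mulVar-distrib : ∀ {n} i (x y : Monomial n) → lcm (mulVar i x) (mulVar i y) ≡ mulVar i (lcm x y)
lcm-mulVar-distrib zero    (a ∷ x) (b ∷ y) = refl
lcm-mulVar-distrib (suc i) (a ∷ x) (b ∷ y) = cong (a ⊔ b ∷_) (lcm-mulVar-distrib i x y)

mulVar-cong-mulVar : ∀ {n} l {i j} {x v : Monomial n} → mulVar i x ≡ mulVar j v →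
  mulVar i (mulVar l x) ≡ mulVar j (mulVar l v)
mulVar-cong-mulVar l {i} {j} {x} {v} eq =
  trans (mulVar-comm i l x) (trans (cong (mulVar l) eq) (mulVar-comm l j v))

InClique-mulVar : ∀ {n} (c : CliqueType n) l {v x} → InClique c v x → InClique c (mulVar l v) (mulVar l x)
InClique-mulVar (down i) l (j , eq) = j , mulVar-cong-mulVar l eq
InClique-mulVar (up t)   l (i , eq) = i , mulVar-cong-mulVar l eq

deg≡0⇒≡0⃗ : ∀ {n} (x : Monomial n) → deg x ≡ 0 → x ≡ replicate n 0
deg≡0⇒≡0⃗ []      _        = refl
deg≡0⇒≡0⃗ (a ∷ x) a+dx≡0 = cong₂ _∷_ (m+n≡0⇒m≡0 a a+dx≡0) (deg≡0⇒≡0⃗ x (m+n≡0⇒n≡0 a a+dx≡0))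

HasParity : ∀ {n} → Parity → Monomial n → Set
HasParity p = V.All (λ a → parity a ≡ p)

SameParity : ∀ {n} → Monomial n → Set
SameParity x = ∃[ p ] HasParity p x

sameParity? : ∀ {n} (x : Monomial n) → Dec (SameParity x)
sameParity? x with V.all? (λ a → parity a ≟ℙ 0ℙ) x | V.all? (λ a → parity a ≟ℙ 1ℙ) x
... | yes x₀ | _      = yes (0ℙ , x₀)
... | no _   | yes x₁ = yes (1ℙ , x₁)
... | no ¬x₀ | no ¬x₁ = no λ { (0ℙ , x₀) → ¬x₀ x₀ ; (1ℙ , x₁) → ¬x₁ x₁ }

HasParity-lcm : ∀ {n p} {x y : Monomial n} → HasParity p x → HasParity p y → HasParity p (lcm x y)
HasParity-lcm []                 []                 = []
HasParity-lcm {x = a ∷ _} {b ∷ _} (pa ∷ px) (pb ∷ py) = parity-⊔ ∷ HasParity-lcm px py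
  where
  parity-⊔ : parity (a ⊔ b) ≡ _
  parity-⊔ with ⊔-sel a b
  ... | inj₁ a⊔b≡a = trans (cong parity a⊔b≡a) pa
  ... | inj₂ a⊔b≡b = trans (cong parity a⊔b≡b) pb

HasParity-deg : ∀ {n p} {x y : Monomial n} → HasParity p x → HasParity p y → parity (deg x) ≡ parity (deg y)
HasParity-deg                   []        []        = refl
HasParity-deg {x = a ∷ x} {b ∷ y} (pa ∷ px) (pb ∷ py) = begin
  parity (a + deg x)              ≡⟨ +-homo-+ a (deg x) ⟩
  parity a ℙ.+ parity (deg x)     ≡⟨ cong₂ ℙ._+_ (trans pa (sym pb)) (HasParity-deg px py) ⟩
  parity b ℙ.+ parity (deg y)     ≡⟨ +-homo-+ b (deg y) ⟨
  parity (b + deg y)              ∎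
  where open ≡-Reasoning

⊔-parity-bound : ∀ a b → parity a ≢ parity b → suc (a + b) ≤ (a ⊔ b) + (a ⊔ b)
⊔-parity-bound a b pa≢pb with <-cmp a b
... | tri< a<b _ _ rewrite m≤n⇒m⊔n≡n (<⇒≤ a<b) = +-monoˡ-< b a<b
... | tri≈ _ refl _ = contradiction refl pa≢pb
... | tri> _ _ b<a rewrite m≥n⇒m⊔n≡m (<⇒≤ b<a) = +-monoʳ-< a b<a

-- Exponents of different parity differ, so each exponent of lcm x y exceeds their mean by at least 1/2.
deg-lcm-bound : ∀ {n p q} {x y : Monomial n} → p ≢ q → HasParity p x → HasParity q y →
  n + (deg x + deg y) ≤ deg (lcm x y) + deg (lcm x y)
deg-lcm-bound p≢q [] [] = z≤n
deg-lcm-bound {suc n} {x = a ∷ x} {b ∷ y} p≢q (pa ∷ px) (qb ∷ qy) =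
  subst₂ _≤_ (lhs a b n (deg x) (deg y)) (rhs (a ⊔ b) (deg (lcm x y)))
    (+-mono-≤ (⊔-parity-bound a b (λ pa≡pb → p≢q (trans (sym pa) (trans pa≡pb qb))))
              (deg-lcm-bound p≢q px qy))
  where
  lhs : ∀ a b n X Y → suc (a + b) + (n + (X + Y)) ≡ suc n + ((a + X) + (b + Y))
  lhs = solve-∀
  rhs : ∀ m L → (m + m) + (L + L) ≡ (m + L) + (m + L)
  rhs = solve-∀

SameParity-nonadjacent : ∀ {n} {x y : Monomial n} → 3 ≤ n →
  SameParity x → SameParity y → deg y ≡ deg x → ¬ Adjacent x y
SameParity-nonadjacent {n} {x} {y} 3≤n (p , px) (q , qy) dy≡dx adj with p ≟ℙ q
... | yes refl = p≢p⁻¹ (parity (deg x)) (sym (trans (cong _⁻¹ parity-shift) (suc-homo-⁻¹ (deg x))))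
  where
  parity-shift : parity (deg x) ≡ parity (suc (deg x))
  parity-shift = trans (HasParity-deg px (HasParity-lcm px qy)) (cong parity adj)
... | no p≢q = contradiction (+-cancelʳ-≤ (deg x + deg x) n 2 bound) (<⇒≱ 3≤n)
  where
  bound : n + (deg x + deg x) ≤ 2 + (deg x + deg x)
  bound = begin
    n + (deg x + deg x)                     ≡⟨ cong (λ z → n + (deg x + z)) dy≡dx ⟨
    n + (deg x + deg y)                     ≤⟨ deg-lcm-bound p≢q px qy ⟩
    deg (lcm x y) + deg (lcm x y)           ≡⟨ cong₂ _+_ adj adj ⟩
    suc (deg x) + suc (deg x)               ≡⟨ cong suc (+-suc (deg x) (deg x)) ⟩
    2 + (deg x + deg x)                     ∎
    where open ≤-Reasoning

boundedMonomials : ℕ → (n : ℕ) → List (Monomial n)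
boundedMonomials d zero    = [] ∷ []
boundedMonomials d (suc n) = cartesianProductWith _∷_ (upTo (suc d)) (boundedMonomials d n)

boundedMonomials-unique : ∀ d n → Unique (boundedMonomials d n)
boundedMonomials-unique d zero    = All.[] ∷ []
boundedMonomials-unique d (suc n) =
  Unique.cartesianProductWith⁺ _∷_ Vec.∷-injective (Unique.upTo⁺ (suc d)) (boundedMonomials-unique d n)

∈-boundedMonomials : ∀ {d n} (x : Monomial n) → deg x ≤ d → x ∈ boundedMonomials d n
∈-boundedMonomials []      _         = here refl
∈-boundedMonomials (a ∷ x) a+dx≤d = ∈-cartesianProductWith⁺ _∷_
  (∈-upTo⁺ (s≤s (m+n≤o⇒m≤o a a+dx≤d))) (∈-boundedMonomials x (m+n≤o⇒n≤o a a+dx≤d))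

module _ {n : ℕ} (d : ℕ) where

  ofDegree : List (Monomial n) → List (S n d)
  ofDegree []       = []
  ofDegree (x ∷ xs) with deg x ℕ.≟ d
  ... | yes p = (x , p) ∷ ofDegree xs
  ... | no _  = ofDegree xs

  ofDegree-⊆ : ∀ xs {f} → f ∈ ofDegree xs → proj₁ f ∈ xs
  ofDegree-⊆ (x ∷ xs) f∈ with deg x ℕ.≟ d | f∈
  ... | yes p | here refl = here refl
  ... | yes p | there f∈′ = there (ofDegree-⊆ xs f∈′)
  ... | no _  | f∈′       = there (ofDegree-⊆ xs f∈′)

  ∈-ofDegree : ∀ xs {x} → x ∈ xs → (p : deg x ≡ d) → (x , p) ∈ ofDegree xs
  ∈-ofDegree (y ∷ xs) x∈ p with deg y ℕ.≟ d | x∈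
  ... | yes q | here refl = here (S-≡ refl)
  ... | yes q | there x∈′ = there (∈-ofDegree xs x∈′ p)
  ... | no ¬q | here refl = contradiction p ¬q
  ... | no ¬q | there x∈′ = ∈-ofDegree xs x∈′ p

  ofDegree-unique : ∀ {xs} → Unique xs → Unique (ofDegree xs)
  ofDegree-unique {[]}     _          = []
  ofDegree-unique {x ∷ xs} (x∉xs ∷ u) with deg x ℕ.≟ d
  ... | yes p = All.tabulate (λ f∈ x≡f → All.lookup x∉xs (ofDegree-⊆ xs f∈) (cong proj₁ x≡f))
                ∷ ofDegree-unique u
  ... | no _  = ofDegree-unique u

-- Abstract, since unfolding the enumeration makes type checking very slow.
abstract
  vertices : ∀ n d → List (S n d)
  vertices n d = ofDegree d (boundedMonomials d n)

  vertices-unique : ∀ n d → Unique (vertices n d)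
  vertices-unique n d = ofDegree-unique d (boundedMonomials-unique d n)

  ∈-vertices : ∀ {n d} (f : S n d) → f ∈ vertices n d
  ∈-vertices {n} {d} (x , p) = ∈-ofDegree d (boundedMonomials d n) (∈-boundedMonomials x (≤-reflexive p)) p

double : ℕ → ℕ
double zero    = zero
double (suc n) = suc (suc (double n))

2*n≡double : ∀ n → 2 * n ≡ double n
2*n≡double zero    = refl
2*n≡double (suc n) = cong suc (trans (+-suc n (n + 0)) (cong suc (2*n≡double n)))

⌊double/2⌋ : ∀ n → ⌊ double n /2⌋ ≡ n
⌊double/2⌋ zero    = refl
⌊double/2⌋ (suc n) = cong suc (⌊double/2⌋ n)

⌊1+double/2⌋ : ∀ n → ⌊ suc (double n) /2⌋ ≡ n
⌊1+double/2⌋ zero    = refl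
⌊1+double/2⌋ (suc n) = cong suc (⌊1+double/2⌋ n)

parity-double : ∀ n → parity (double n) ≡ 0ℙ
parity-double zero    = refl
parity-double (suc n) = parity-double n

parity-1+double : ∀ n → parity (suc (double n)) ≡ 1ℙ
parity-1+double zero    = refl
parity-1+double (suc n) = parity-1+double n

data ParityView : ℕ → Set where
  even : ∀ q → ParityView (double q)
  odd  : ∀ q → ParityView (suc (double q))

parityView : ∀ n → ParityView n
parityView zero          = even zero
parityView (suc zero)    = odd zero
parityView (suc (suc n)) with parityView n
... | even q = even (suc q)
... | odd q  = odd (suc q)

parityOf : ∀ {n} → ParityView n → Parity
parityOf (even _) = 0ℙ
parityOf (odd _)  = 1ℙ

parity-parityView : ∀ {n} (v : ParityView n) → parity n ≡ parityOf v
parity-parityView (even q) = parity-double q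
parity-parityView (odd q)  = parity-1+double q

deg-oddParity : ∀ {a b c} e (va : ParityView a) (vb : ParityView b) (vc : ParityView c) →
  parityOf va ℙ.+ (parityOf vb ℙ.+ (parityOf vc ℙ.+ parity e)) ≡ 1ℙ →
  parity (deg (a ∷ b ∷ c ∷ e ∷ [])) ≢ 0ℙ
deg-oddParity {a} {b} {c} e va vb vc odd-sum even-deg = 1ℙ≢0ℙ (begin
  1ℙ                                                       ≡⟨ odd-sum ⟨
  parityOf va ℙ.+ (parityOf vb ℙ.+ (parityOf vc ℙ.+ parity e)) ≡⟨ parities ⟨
  parity (deg (a ∷ b ∷ c ∷ e ∷ []))                         ≡⟨ even-deg ⟩
  0ℙ                                                       ∎)
  where
  open ≡-Reasoning
  1ℙ≢0ℙ : 1ℙ ≢ 0ℙ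
  1ℙ≢0ℙ ()
  parities : parity (a + (b + (c + (e + 0)))) ≡ parityOf va ℙ.+ (parityOf vb ℙ.+ (parityOf vc ℙ.+ parity e))
  parities rewrite +-homo-+ a (b + (c + (e + 0))) | +-homo-+ b (c + (e + 0)) | +-homo-+ c (e + 0)
                 | +-identityʳ e | parity-parityView va | parity-parityView vb | parity-parityView vc = refl

data Shape : Set where
  dominant : Fin 3 → Shape
  balanced : Shape

shape : ℕ → ℕ → ℕ → Shape
shape p q r with q + r <? p
... | yes _ = dominant (# 0)
... | no _ with p + r <? q
...   | yes _ = dominant (# 1)
...   | no _ with p + q <? r
...     | yes _ = dominant (# 2)
...     | no _  = balanced

dominant-asym : ∀ {x y z w} → x + z < y → y + w < x → ⊥
dominant-asym {x} {y} {z} {w} x+z<y y+w<x =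
  <-irrefl refl (<-trans (≤-<-trans (m≤m+n x z) x+z<y) (≤-<-trans (m≤m+n y w) y+w<x))

shape-dominant₀ : ∀ p q r → q + r < p → shape p q r ≡ dominant (# 0)
shape-dominant₀ p q r h with q + r <? p
... | yes _ = refl
... | no ¬h = contradiction h ¬h

shape-dominant₁ : ∀ p q r → p + r < q → shape p q r ≡ dominant (# 1)
shape-dominant₁ p q r h with q + r <? p
... | yes h₀ = ⊥-elim (dominant-asym h₀ h)
... | no _ with p + r <? q
...   | yes _ = refl
...   | no ¬h = contradiction h ¬h

shape-dominant₂ : ∀ p q r → p + q < r → shape p q r ≡ dominant (# 2)
shape-dominant₂ p q r h with q + r <? p
... | yes h₀ = ⊥-elim (dominant-asym (subst (_< p) (+-comm q r) h₀) h)
... | no _ with p + r <? q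
...   | yes h₁ = ⊥-elim (dominant-asym (subst (_< q) (+-comm p r) h₁) (subst (_< r) (+-comm p q) h))
...   | no _ with p + q <? r
...     | yes _ = refl
...     | no ¬h = contradiction h ¬h

shape-dominant₀-or-balanced : ∀ p q r → q ≤ p + r → r ≤ p + q →
  shape p q r ≡ dominant (# 0) ⊎ shape p q r ≡ balanced
shape-dominant₀-or-balanced p q r q≤ r≤ with q + r <? p
... | yes _ = inj₁ refl
... | no _ with p + r <? q
...   | yes h = contradiction q≤ (<⇒≱ h)
...   | no _ with p + q <? r
...     | yes h = contradiction r≤ (<⇒≱ h)
...     | no _  = inj₂ refl

shape-dominant₁-or-balanced : ∀ p q r → p ≤ q + r → r ≤ p + q →
  shape p q r ≡ dominant (# 1) ⊎ shape p q r ≡ balanced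
shape-dominant₁-or-balanced p q r p≤ r≤ with q + r <? p
... | yes h = contradiction p≤ (<⇒≱ h)
... | no _ with p + r <? q
...   | yes _ = inj₁ refl
...   | no _ with p + q <? r
...     | yes h = contradiction r≤ (<⇒≱ h)
...     | no _  = inj₂ refl

shape-dominant₂-or-balanced : ∀ p q r → p ≤ q + r → q ≤ p + r →
  shape p q r ≡ dominant (# 2) ⊎ shape p q r ≡ balanced
shape-dominant₂-or-balanced p q r p≤ q≤ with q + r <? p
... | yes h = contradiction p≤ (<⇒≱ h)
... | no _ with p + r <? q
...   | yes h = contradiction q≤ (<⇒≱ h)
...   | no _ with p + q <? r
...     | yes _ = inj₁ refl
...     | no _  = inj₂ refl

Low : Monomial 4 → Set
Low x = lookup x (# 3) ≤ 1

allEven allOdd : ℕ → ℕ → ℕ → Monomial 4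
allEven a b c = double a ∷ double b ∷ double c ∷ 0 ∷ []
allOdd  a b c = suc (double a) ∷ suc (double b) ∷ suc (double c) ∷ 1 ∷ []

typeOf : Parity → Shape → CliqueType 4
typeOf 0ℙ (dominant i) = down (inject₁ i)
typeOf 0ℙ balanced     = up (# 3)
typeOf 1ℙ (dominant i) = up (inject₁ i)
typeOf 1ℙ balanced     = down (# 3)

cliqueType : Monomial 4 → CliqueType 4
cliqueType (a ∷ b ∷ c ∷ e ∷ []) = typeOf (parity e) (shape ⌊ a /2⌋ ⌊ b /2⌋ ⌊ c /2⌋)

typeOf-cases : ∀ p {s s₁ s₂} → s ≡ s₁ ⊎ s ≡ s₂ → typeOf p s ≡ typeOf p s₁ ⊎ typeOf p s ≡ typeOf p s₂
typeOf-cases p = Sum.map (cong (typeOf p)) (cong (typeOf p))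

SlabLabel : Monomial 4 → Set
SlabLabel x = ∃[ v ] SameParity v × Low v × InClique (cliqueType v) v x

allEven-sameParity : ∀ a b c → SameParity (allEven a b c)
allEven-sameParity a b c = 0ℙ , parity-double a ∷ parity-double b ∷ parity-double c ∷ refl ∷ []

allOdd-sameParity : ∀ a b c → SameParity (allOdd a b c)
allOdd-sameParity a b c = 1ℙ , parity-1+double a ∷ parity-1+double b ∷ parity-1+double c ∷ refl ∷ []

cliqueType-allEven : ∀ a b c → cliqueType (allEven a b c) ≡ typeOf 0ℙ (shape a b c)
cliqueType-allEven a b c rewrite ⌊double/2⌋ a | ⌊double/2⌋ b | ⌊double/2⌋ c = refl

cliqueType-allOdd : ∀ a b c → cliqueType (allOdd a b c) ≡ typeOf 1ℙ (shape a b c)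
cliqueType-allOdd a b c rewrite ⌊1+double/2⌋ a | ⌊1+double/2⌋ b | ⌊1+double/2⌋ c = refl

allEven-label : ∀ a b c {x i t} → mulVar i x ≡ mulVar t (allEven a b c) →
  typeOf 0ℙ (shape a b c) ≡ down i ⊎ typeOf 0ℙ (shape a b c) ≡ up t → SlabLabel x
allEven-label a b c x·xᵢ≡v·xₜ type = allEven a b c , allEven-sameParity a b c , z≤n ,
  mulVar-InClique x·xᵢ≡v·xₜ (subst (λ T → T ≡ down _ ⊎ T ≡ up _) (sym (cliqueType-allEven a b c)) type)

allOdd-label : ∀ a b c {x i t} → mulVar i x ≡ mulVar t (allOdd a b c) →
  typeOf 1ℙ (shape a b c) ≡ down i ⊎ typeOf 1ℙ (shape a b c) ≡ up t → SlabLabel x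
allOdd-label a b c x·xᵢ≡v·xₜ type = allOdd a b c , allOdd-sameParity a b c , s≤s z≤n ,
  mulVar-InClique x·xᵢ≡v·xₜ (subst (λ T → T ≡ down _ ⊎ T ≡ up _) (sym (cliqueType-allOdd a b c)) type)

≰-total : ∀ {m n} → ¬ m ≤ n → ¬ n ≤ m → ⊥
≰-total m≰n n≰m = m≰n (<⇒≤ (≰⇒> n≰m))

m+1+n≰o⇒o≤m+n : ∀ m n {o} → ¬ m + suc n ≤ o → o ≤ m + n
m+1+n≰o⇒o≤m+n m n {o} h = ≤-pred (subst (o <_) (+-suc m n) (≰⇒> h))

o≤1+m+n⇒o≤m+1+n : ∀ m n {o} → o ≤ suc (m + n) → o ≤ m + suc n
o≤1+m+n⇒o≤m+1+n m n h = ≤-trans h (≤-reflexive (sym (+-suc m n)))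

label-OOE : ∀ a b c → SlabLabel (suc (double a) ∷ suc (double b) ∷ double c ∷ 0 ∷ [])
label-OOE a b c with b + c ≤? a | a + c ≤? b
... | yes h | _ = allEven-label (suc a) b c {i = # 0} {t = # 1} refl
  (inj₁ (cong (typeOf 0ℙ) (shape-dominant₀ (suc a) b c (s≤s h))))
... | no _ | yes h = allEven-label a (suc b) c {i = # 1} {t = # 0} refl
  (inj₁ (cong (typeOf 0ℙ) (shape-dominant₁ a (suc b) c (s≤s h))))
label-OOE a b zero    | no h₁ | no h₂ =
  ⊥-elim (≰-total (h₂ ∘ ≤-trans (≤-reflexive (+-identityʳ a))) (h₁ ∘ ≤-trans (≤-reflexive (+-identityʳ b))))
label-OOE a b (suc c) | no h₁ | no h₂ = allOdd-label a b c {i = # 3} {t = # 2} refl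
  (Sum.swap (typeOf-cases 1ℙ (shape-dominant₂-or-balanced a b c (m+1+n≰o⇒o≤m+n b c h₁) (m+1+n≰o⇒o≤m+n a c h₂))))

label-OEO : ∀ a b c → SlabLabel (suc (double a) ∷ double b ∷ suc (double c) ∷ 0 ∷ [])
label-OEO a b c with b + c ≤? a | a + b ≤? c
... | yes h | _ = allEven-label (suc a) b c {i = # 0} {t = # 2} refl
  (inj₁ (cong (typeOf 0ℙ) (shape-dominant₀ (suc a) b c (s≤s h))))
... | no _ | yes h = allEven-label a b (suc c) {i = # 2} {t = # 0} refl
  (inj₁ (cong (typeOf 0ℙ) (shape-dominant₂ a b (suc c) (s≤s h))))
label-OEO a zero c    | no h₁ | no h₂ = ⊥-elim (≰-total h₁ (h₂ ∘ ≤-trans (≤-reflexive (+-identityʳ a))))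
label-OEO a (suc b) c | no h₁ | no h₂ = allOdd-label a b c {i = # 3} {t = # 1} refl
  (Sum.swap (typeOf-cases 1ℙ (shape-dominant₁-or-balanced a b c (≤-pred (≰⇒> h₁)) (m+1+n≰o⇒o≤m+n a b h₂))))

label-EOO : ∀ a b c → SlabLabel (double a ∷ suc (double b) ∷ suc (double c) ∷ 0 ∷ [])
label-EOO a b c with a + c ≤? b | a + b ≤? c
... | yes h | _ = allEven-label a (suc b) c {i = # 1} {t = # 2} refl
  (inj₁ (cong (typeOf 0ℙ) (shape-dominant₁ a (suc b) c (s≤s h))))
... | no _ | yes h = allEven-label a b (suc c) {i = # 2} {t = # 1} refl
  (inj₁ (cong (typeOf 0ℙ) (shape-dominant₂ a b (suc c) (s≤s h))))
label-EOO zero    b c | no h₁ | no h₂ = ⊥-elim (≰-total h₁ h₂)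
label-EOO (suc a) b c | no h₁ | no h₂ = allOdd-label a b c {i = # 3} {t = # 0} refl
  (Sum.swap (typeOf-cases 1ℙ (shape-dominant₀-or-balanced a b c (≤-pred (≰⇒> h₁)) (≤-pred (≰⇒> h₂)))))

label-OEE : ∀ a b c → SlabLabel (suc (double a) ∷ double b ∷ double c ∷ 1 ∷ [])
label-OEE a b c with suc (a + b) <? c | suc (a + c) <? b
label-OEE a b zero    | yes () | _
label-OEE a b (suc c) | yes h  | _ = allOdd-label a b c {i = # 1} {t = # 2} refl
  (inj₂ (cong (typeOf 1ℙ) (shape-dominant₂ a b c (≤-pred h))))
label-OEE a zero c    | no _ | yes ()
label-OEE a (suc b) c | no _ | yes h = allOdd-label a b c {i = # 2} {t = # 1} refl
  (inj₂ (cong (typeOf 1ℙ) (shape-dominant₁ a b c (≤-pred h))))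
label-OEE a b c | no h₁ | no h₂ = allEven-label (suc a) b c {i = # 0} {t = # 3} refl
  (typeOf-cases 0ℙ (shape-dominant₀-or-balanced (suc a) b c (≮⇒≥ h₂) (≮⇒≥ h₁)))

label-EOE : ∀ a b c → SlabLabel (double a ∷ suc (double b) ∷ double c ∷ 1 ∷ [])
label-EOE a b c with suc (a + b) <? c | suc (b + c) <? a
label-EOE a b zero    | yes () | _
label-EOE a b (suc c) | yes h  | _ = allOdd-label a b c {i = # 0} {t = # 2} refl
  (inj₂ (cong (typeOf 1ℙ) (shape-dominant₂ a b c (≤-pred h))))
label-EOE zero b c    | no _ | yes ()
label-EOE (suc a) b c | no _ | yes h = allOdd-label a b c {i = # 2} {t = # 0} refl
  (inj₂ (cong (typeOf 1ℙ) (shape-dominant₀ a b c (≤-pred h))))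
label-EOE a b c | no h₁ | no h₂ = allEven-label a (suc b) c {i = # 1} {t = # 3} refl
  (typeOf-cases 0ℙ (shape-dominant₁-or-balanced a (suc b) c (≮⇒≥ h₂) (o≤1+m+n⇒o≤m+1+n a b (≮⇒≥ h₁))))

label-EEO : ∀ a b c → SlabLabel (double a ∷ double b ∷ suc (double c) ∷ 1 ∷ [])
label-EEO a b c with suc (b + c) <? a | suc (a + c) <? b
label-EEO zero b c    | yes () | _
label-EEO (suc a) b c | yes h  | _ = allOdd-label a b c {i = # 1} {t = # 0} refl
  (inj₂ (cong (typeOf 1ℙ) (shape-dominant₀ a b c (≤-pred h))))
label-EEO a zero c    | no _ | yes ()
label-EEO a (suc b) c | no _ | yes h = allOdd-label a b c {i = # 0} {t = # 1} refl
  (inj₂ (cong (typeOf 1ℙ) (shape-dominant₁ a b c (≤-pred h))))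
label-EEO a b c | no h₁ | no h₂ = allEven-label a b (suc c) {i = # 2} {t = # 3} refl
  (typeOf-cases 0ℙ (shape-dominant₂-or-balanced a b (suc c) (o≤1+m+n⇒o≤m+1+n b c (≮⇒≥ h₁)) (o≤1+m+n⇒o≤m+1+n a c (≮⇒≥ h₂))))

slabLabel : ∀ x → parity (deg x) ≡ 0ℙ → Low x → SlabLabel x
slabLabel (x₁ ∷ x₂ ∷ x₃ ∷ 0 ∷ []) even-deg _ with parityView x₁ | parityView x₂ | parityView x₃
... | even a | even b | even c =
  allEven a b c , allEven-sameParity a b c , z≤n , InClique-refl (cliqueType (allEven a b c)) _
... | odd a  | odd b  | even c = label-OOE a b c
... | odd a  | even b | odd c  = label-OEO a b c
... | even a | odd b  | odd c  = label-EOO a b c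
... | va@(odd _)  | vb@(even _) | vc@(even _) = ⊥-elim (deg-oddParity 0 va vb vc refl even-deg)
... | va@(even _) | vb@(odd _)  | vc@(even _) = ⊥-elim (deg-oddParity 0 va vb vc refl even-deg)
... | va@(even _) | vb@(even _) | vc@(odd _)  = ⊥-elim (deg-oddParity 0 va vb vc refl even-deg)
... | va@(odd _)  | vb@(odd _)  | vc@(odd _)  = ⊥-elim (deg-oddParity 0 va vb vc refl even-deg)
slabLabel (x₁ ∷ x₂ ∷ x₃ ∷ 1 ∷ []) even-deg _ with parityView x₁ | parityView x₂ | parityView x₃
... | odd a  | odd b  | odd c  =
  allOdd a b c , allOdd-sameParity a b c , s≤s z≤n , InClique-refl (cliqueType (allOdd a b c)) _
... | odd a  | even b | even c = label-OEE a b c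
... | even a | odd b  | even c = label-EOE a b c
... | even a | even b | odd c  = label-EEO a b c
... | va@(even _) | vb@(even _) | vc@(even _) = ⊥-elim (deg-oddParity 1 va vb vc refl even-deg)
... | va@(odd _)  | vb@(odd _)  | vc@(even _) = ⊥-elim (deg-oddParity 1 va vb vc refl even-deg)
... | va@(odd _)  | vb@(even _) | vc@(odd _)  = ⊥-elim (deg-oddParity 1 va vb vc refl even-deg)
... | va@(even _) | vb@(odd _)  | vc@(odd _)  = ⊥-elim (deg-oddParity 1 va vb vc refl even-deg)
slabLabel (_ ∷ _ ∷ _ ∷ suc (suc _) ∷ []) _ (s≤s ())

lift : Monomial 4 → Monomial 4
lift = mulVar (# 3) ∘ mulVar (# 3)

deg-lift : ∀ x → deg (lift x) ≡ suc (suc (deg x))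
deg-lift x = trans (deg-mulVar (# 3) (mulVar (# 3) x)) (cong suc (deg-mulVar (# 3) x))

lift-injective : ∀ {x y} → lift x ≡ lift y → x ≡ y
lift-injective = mulVar-injective (# 3) ∘ mulVar-injective (# 3)

¬Low-lift : ∀ x → ¬ Low (lift x)
¬Low-lift (_ ∷ _ ∷ _ ∷ _ ∷ []) (s≤s ())

SameParity-lift : ∀ {x} → SameParity x → SameParity (lift x)
SameParity-lift {_ ∷ _ ∷ _ ∷ _ ∷ []} (p , pa ∷ pb ∷ pc ∷ pe ∷ []) = p , pa ∷ pb ∷ pc ∷ pe ∷ []

cliqueType-lift : ∀ v → cliqueType (lift v) ≡ cliqueType v
cliqueType-lift (_ ∷ _ ∷ _ ∷ _ ∷ []) = refl

record Label (x v : Monomial 4) : Set where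
  field
    sameParity : SameParity v
    inClique   : InClique (cliqueType v) v x
    low        : Low x → Low v

SlabLabel⇒Label : ∀ {x} → SlabLabel x → ∃[ v ] Label x v
SlabLabel⇒Label (v , sp , v-low , x∈) = v , record { sameParity = sp ; inClique = x∈ ; low = λ _ → v-low }

label : ∀ x → parity (deg x) ≡ 0ℙ → ∃[ v ] Label x v
label x@(_ ∷ _ ∷ _ ∷ 0 ∷ []) even-deg = SlabLabel⇒Label (slabLabel x even-deg z≤n)
label x@(_ ∷ _ ∷ _ ∷ 1 ∷ []) even-deg = SlabLabel⇒Label (slabLabel x even-deg (s≤s z≤n))
label (a ∷ b ∷ c ∷ suc (suc e) ∷ []) even-deg
  with label (a ∷ b ∷ c ∷ e ∷ []) (trans (cong parity (sym (deg-lift (a ∷ b ∷ c ∷ e ∷ [])))) even-deg)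
... | v , ℓ = lift v , record
  { sameParity = SameParity-lift (Label.sameParity ℓ)
  ; inClique   = subst (λ T → InClique T (lift v) _) (sym (cliqueType-lift v))
                   (InClique-mulVar _ (# 3) (InClique-mulVar _ (# 3) (Label.inClique ℓ)))
  ; low        = λ { (s≤s ()) }
  }

even-deg : ∀ {k} (f : S 4 (double k)) → parity (deg (proj₁ f)) ≡ 0ℙ
even-deg {k} (x , p) = trans (cong parity p) (parity-double k)

labelOf : ∀ {k} (f : S 4 (double k)) → ∃[ v ] Label (proj₁ f) v
labelOf f = label (proj₁ f) (even-deg f)

labelS : ∀ {k} → S 4 (double k) → S 4 (double k)
labelS f = proj₁ (labelOf f) , trans (sym (deg-InClique _ _ (Label.inClique (proj₂ (labelOf f))))) (proj₂ f)

labelS-near : ∀ {k} {f g : S 4 (double k)} → labelS f ≡ labelS g → Near f g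
labelS-near {f = f} {g} eq with InClique-near _ _ (Label.inClique (proj₂ (labelOf f)))
  (subst (λ v → InClique (cliqueType v) v (proj₁ g)) (sym (cong proj₁ eq)) (Label.inClique (proj₂ (labelOf g))))
... | inj₁ x≡y = inj₁ (S-≡ x≡y)
... | inj₂ adj = inj₂ (trans adj (cong suc (proj₂ f)))

sameParityS? : ∀ {n d} → Decidable (λ (f : S n d) → SameParity (proj₁ f))
sameParityS? f = sameParity? (proj₁ f)

pureVertices : ∀ k → List (S 4 (double k))
pureVertices k = filter sameParityS? (vertices 4 (double k))

∈-pureVertices : ∀ {k} {f : S 4 (double k)} → SameParity (proj₁ f) → f ∈ pureVertices k
∈-pureVertices {f = f} sp = ∈-filter⁺ sameParityS? (∈-vertices f) sp

pureVertices-sameParity : ∀ {k} {f : S 4 (double k)} → f ∈ pureVertices k → SameParity (proj₁ f)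
pureVertices-sameParity {k} f∈ = proj₂ (∈-filter⁻ sameParityS? {xs = vertices 4 (double k)} f∈)

pureVertices-unique : ∀ k → Unique (pureVertices k)
pureVertices-unique k = Unique.filter⁺ sameParityS? (vertices-unique 4 (double k))

pureVertices-independent : ∀ k → IndependentSet 4 (double k) (pureVertices k)
pureVertices-independent k = pureVertices-unique k , λ {f} {g} f∈ g∈ adj →
  SameParity-nonadjacent (s≤s (s≤s (s≤s z≤n))) (pureVertices-sameParity f∈) (pureVertices-sameParity g∈)
    (trans (proj₂ g) (sym (proj₂ f))) (trans adj (cong suc (sym (proj₂ f))))

independent⇒length≤ : ∀ k {J} → IndependentSet 4 (double k) J → length J ≤ length (pureVertices k)
independent⇒length≤ k ind =
  cliqueCover-length≤ labelS labelS-near ind (λ {f} _ → ∈-pureVertices (Label.sameParity (proj₂ (labelOf f))))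

low? : ∀ {d} → Decidable (λ (f : S 4 d) → Low (proj₁ f))
low? f = lookup (proj₁ f) (# 3) ≤? 1

independent⇒lowLength≤ : ∀ {k J} → IndependentSet 4 (double k) J →
  length (filter low? J) ≤ length (filter low? (pureVertices k))
independent⇒lowLength≤ {J = J} ind = cliqueCover-length≤ labelS labelS-near (filter-independent low? ind)
  λ {f} f∈ → ∈-filter⁺ low? (∈-pureVertices (Label.sameParity (proj₂ (labelOf f))))
               (Label.low (proj₂ (labelOf f)) (proj₂ (∈-filter⁻ low? {xs = J} f∈)))

data Height : Monomial 4 → Set where
  low  : ∀ {x} → Low x → Height x
  high : ∀ x → Height (lift x)

height : ∀ x → Height x
height (_ ∷ _ ∷ _ ∷ 0 ∷ [])             = low z≤n
height (_ ∷ _ ∷ _ ∷ 1 ∷ [])             = low (s≤s z≤n)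
height (a ∷ b ∷ c ∷ suc (suc e) ∷ []) = high (a ∷ b ∷ c ∷ e ∷ [])

liftS : ∀ {d} → S 4 d → S 4 (suc (suc d))
liftS (x , p) = lift x , trans (deg-lift x) (cong (2 +_) p)

deg-unlift : ∀ {d} x → deg (lift x) ≡ suc (suc d) → deg x ≡ d
deg-unlift x p = suc-injective (suc-injective (trans (sym (deg-lift x)) p))

lower : ∀ {d} → List (S 4 (suc (suc d))) → List (S 4 d)
lower []            = []
lower ((x , p) ∷ L) with height x
... | low _  = lower L
... | high y = (y , deg-unlift y p) ∷ lower L

lower-⊆ : ∀ {d} L {f : S 4 d} → f ∈ lower L → liftS f ∈ L
lower-⊆ ((x , p) ∷ L) f∈ with height x | f∈
... | low _  | f∈′       = there (lower-⊆ L f∈′)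
... | high y | here refl = here (S-≡ refl)
... | high y | there f∈′ = there (lower-⊆ L f∈′)

∈-lower : ∀ {d} L {f : S 4 d} → liftS f ∈ L → f ∈ lower L
∈-lower ((x , p) ∷ L) {y , q} f∈ with height x | f∈
... | low x-low | here eq   = contradiction (subst Low (sym (cong proj₁ eq)) x-low) (¬Low-lift y)
... | low _     | there f∈′ = ∈-lower L f∈′
... | high z    | here eq   = here (S-≡ (lift-injective (cong proj₁ eq)))
... | high z    | there f∈′ = there (∈-lower L f∈′)

lower-unique : ∀ {d} {L : List (S 4 (suc (suc d)))} → Unique L → Unique (lower L)
lower-unique {L = []}            []         = []
lower-unique {L = (x , p) ∷ L} (f∉L ∷ u) with height x
... | low _  = lower-unique u
... | high y = All.tabulate (λ g∈ y≡g → All.lookup f∉L (lower-⊆ L g∈) (trans (S-≡ refl) (cong liftS y≡g)))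
               ∷ lower-unique u

lcm-lift : ∀ x y → lcm (lift x) (lift y) ≡ lift (lcm x y)
lcm-lift x y = trans (lcm-mulVar-distrib (# 3) _ _) (cong (mulVar (# 3)) (lcm-mulVar-distrib (# 3) x y))

Adj-liftS : ∀ {d} {f g : S 4 d} → Adj f g → Adj (liftS f) (liftS g)
Adj-liftS {f = x , _} {y , _} adj =
  trans (cong deg (lcm-lift x y)) (trans (deg-lift (lcm x y)) (cong (2 +_) adj))

lower-independent : ∀ {d} {L : List (S 4 (suc (suc d)))} → IndependentSet 4 (suc (suc d)) L →
  IndependentSet 4 d (lower L)
lower-independent {L = L} (u , ind) =
  lower-unique u , λ {f} {g} f∈ g∈ adj → ind (lower-⊆ L f∈) (lower-⊆ L g∈) (Adj-liftS {f = f} {g} adj)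

length-lower : ∀ {d} (L : List (S 4 (suc (suc d)))) → length L ≡ length (lower L) + length (filter low? L)
length-lower []            = refl
length-lower ((x , p) ∷ L) with height x
... | low x-low rewrite filter-accept low? {x = x , p} {xs = L} x-low =
  trans (cong suc (length-lower L)) (sym (+-suc _ _))
... | high y rewrite filter-reject low? {x = lift y , p} {xs = L} (¬Low-lift y) =
  cong suc (length-lower L)

pureVertices-⊆-lower : ∀ k → pureVertices k ⊆ lower (pureVertices (suc k))
pureVertices-⊆-lower k f∈ = ∈-lower _ (∈-pureVertices (SameParity-lift (pureVertices-sameParity f∈)))

lower-length≥ : ∀ k {J} → IndependentSet 4 (double (suc k)) J → length (pureVertices (suc k)) ≤ length J →
  length (pureVertices k) ≤ length (lower J)
lower-length≥ k {J} ind large = begin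
  length (pureVertices k)  ≤⟨ Unique-⊆⇒length≤ (pureVertices-unique k) (pureVertices-⊆-lower k) ⟩
  length (lower P)         ≤⟨ +-cancelʳ-≤ (length (filter low? P)) _ _ lowerP+lowP≤lowerJ+lowP ⟩
  length (lower J)         ∎
  where
  open ≤-Reasoning
  P = pureVertices (suc k)
  lowerP+lowP≤lowerJ+lowP : length (lower P) + length (filter low? P) ≤ length (lower J) + length (filter low? P)
  lowerP+lowP≤lowerJ+lowP = begin
    length (lower P) + length (filter low? P) ≡⟨ length-lower P ⟨
    length P                                  ≤⟨ large ⟩
    length J                                  ≡⟨ length-lower J ⟩
    length (lower J) + length (filter low? J) ≤⟨ +-monoʳ-≤ (length (lower J)) (independent⇒lowLength≤ ind) ⟩
    length (lower J) + length (filter low? P) ∎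

swap : Fin 4 → Monomial 4 → Monomial 4
swap zero                    (a ∷ b ∷ c ∷ e ∷ []) = e ∷ b ∷ c ∷ a ∷ []
swap (suc zero)              (a ∷ b ∷ c ∷ e ∷ []) = a ∷ e ∷ c ∷ b ∷ []
swap (suc (suc zero))        (a ∷ b ∷ c ∷ e ∷ []) = a ∷ b ∷ e ∷ c ∷ []
swap (suc (suc (suc zero)))  x                    = x

deg-swap : ∀ i x → deg (swap i x) ≡ deg x
deg-swap zero                   (a ∷ b ∷ c ∷ e ∷ []) = swap₀ a b c e
  where
  swap₀ : ∀ a b c e → e + (b + (c + (a + 0))) ≡ a + (b + (c + (e + 0)))
  swap₀ = solve-∀
deg-swap (suc zero)             (a ∷ b ∷ c ∷ e ∷ []) = cong (a +_) (swap₁ b c e)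
  where
  swap₁ : ∀ b c e → e + (c + (b + 0)) ≡ b + (c + (e + 0))
  swap₁ = solve-∀
deg-swap (suc (suc zero))       (a ∷ b ∷ c ∷ e ∷ []) = cong (λ z → a + (b + z)) (swap₂ c e)
  where
  swap₂ : ∀ c e → e + (c + 0) ≡ c + (e + 0)
  swap₂ = solve-∀
deg-swap (suc (suc (suc zero))) x                    = refl

swap-involutive : ∀ i x → swap i (swap i x) ≡ x
swap-involutive zero                   (_ ∷ _ ∷ _ ∷ _ ∷ []) = refl
swap-involutive (suc zero)             (_ ∷ _ ∷ _ ∷ _ ∷ []) = refl
swap-involutive (suc (suc zero))       (_ ∷ _ ∷ _ ∷ _ ∷ []) = refl
swap-involutive (suc (suc (suc zero))) x                    = refl

lcm-swap : ∀ i x y → lcm (swap i x) (swap i y) ≡ swap i (lcm x y)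
lcm-swap zero                   (_ ∷ _ ∷ _ ∷ _ ∷ []) (_ ∷ _ ∷ _ ∷ _ ∷ []) = refl
lcm-swap (suc zero)             (_ ∷ _ ∷ _ ∷ _ ∷ []) (_ ∷ _ ∷ _ ∷ _ ∷ []) = refl
lcm-swap (suc (suc zero))       (_ ∷ _ ∷ _ ∷ _ ∷ []) (_ ∷ _ ∷ _ ∷ _ ∷ []) = refl
lcm-swap (suc (suc (suc zero))) x                    y                    = refl

SameParity-unswap : ∀ i {x} → SameParity (swap i x) → SameParity x
SameParity-unswap zero {_ ∷ _ ∷ _ ∷ _ ∷ []} (p , pe ∷ pb ∷ pc ∷ pa ∷ []) = p , pa ∷ pb ∷ pc ∷ pe ∷ []
SameParity-unswap (suc zero) {_ ∷ _ ∷ _ ∷ _ ∷ []} (p , pa ∷ pe ∷ pc ∷ pb ∷ []) = p , pa ∷ pb ∷ pc ∷ pe ∷ []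
SameParity-unswap (suc (suc zero)) {_ ∷ _ ∷ _ ∷ _ ∷ []} (p , pa ∷ pb ∷ pe ∷ pc ∷ []) = p , pa ∷ pb ∷ pc ∷ pe ∷ []
SameParity-unswap (suc (suc (suc zero))) sp = sp

swap-lift-0 : ∀ i → swap i (lift (replicate 4 0)) ≡ mulVar i (mulVar i (replicate 4 0))
swap-lift-0 zero                   = refl
swap-lift-0 (suc zero)             = refl
swap-lift-0 (suc (suc zero))       = refl
swap-lift-0 (suc (suc (suc zero))) = refl

swapS : ∀ {d} → Fin 4 → S 4 d → S 4 d
swapS i (x , p) = swap i x , trans (deg-swap i x) p

swapS-independent : ∀ {d} i {J} → IndependentSet 4 d J → IndependentSet 4 d (map (swapS i) J)
swapS-independent i = map-independent (swapS i) (λ (x , _) → S-≡ (swap-involutive i x))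
  λ {(x , _)} {(y , _)} adj → trans (sym (trans (cong deg (lcm-swap i x y)) (deg-swap i (lcm x y)))) adj

LargeSetsArePure : ℕ → Set
LargeSetsArePure k = ∀ {J} → IndependentSet 4 (double k) J → length (pureVertices k) ≤ length J →
  ∀ {f} → f ∈ J → SameParity (proj₁ f)

module _ (k : ℕ) (IH : LargeSetsArePure k) where

  high-sameParity : ∀ {J} → IndependentSet 4 (double (suc k)) J → length (pureVertices (suc k)) ≤ length J →
    ∀ {f} → f ∈ J → ¬ Low (proj₁ f) → SameParity (proj₁ f)
  high-sameParity {J} ind large {x , p} f∈ ¬low with height x
  ... | low x-low = contradiction x-low ¬low
  ... | high y    = SameParity-lift (IH (lower-independent ind) (lower-length≥ k ind large)
                      (∈-lower J {y , deg-unlift y p} (subst (_∈ J) (S-≡ refl) f∈)))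

  swapped-sameParity : ∀ {J} → IndependentSet 4 (double (suc k)) J → length (pureVertices (suc k)) ≤ length J →
    ∀ i {f} → f ∈ J → ¬ Low (swap i (proj₁ f)) → SameParity (proj₁ f)
  swapped-sameParity {J} ind large i f∈ ¬low = SameParity-unswap i
    (high-sameParity (swapS-independent i ind) (subst (_ ≤_) (sym (length-map (swapS i) J)) large)
      (∈-map⁺ (swapS i) f∈) ¬low)

lower-swapS-nonEmpty : ∀ {J} → IndependentSet 4 2 J → length (pureVertices 1) ≤ length J →
  ∀ i → 0 < length (lower (map (swapS i) J))
lower-swapS-nonEmpty {J} ind large i = <-≤-trans
  (∈⇒0<length (∈-pureVertices {0} {replicate 4 0 , refl} (0ℙ , refl ∷ refl ∷ refl ∷ refl ∷ [])))
  (lower-length≥ 0 (swapS-independent i ind) (subst (_ ≤_) (sym (length-map (swapS i) J)) large))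

-- Some vertex of J is divisible by xᵢ² (lower-swapS-nonEmpty), and in degree 2 it is xᵢ².
squareVar∈large : ∀ {J} → IndependentSet 4 2 J → length (pureVertices 1) ≤ length J →
  ∀ i → ∃[ g ] g ∈ J × proj₁ g ≡ mulVar i (mulVar i (replicate 4 0))
squareVar∈large {J} ind large i with 0<length⇒∈ (lower (map (swapS i) J)) (lower-swapS-nonEmpty ind large i)
... | (z , q) , z∈ with ∈-map⁻ (swapS i) (lower-⊆ (map (swapS i) J) z∈)
... | (y , p) , g∈ , liftz≡swapy = (y , p) , g∈ , (begin
  y                              ≡⟨ swap-involutive i y ⟨
  swap i (swap i y)              ≡⟨ cong (swap i ∘ proj₁) liftz≡swapy ⟨
  swap i (lift z)                ≡⟨ cong (swap i ∘ lift) (deg≡0⇒≡0⃗ z q) ⟩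
  swap i (lift (replicate 4 0))  ≡⟨ swap-lift-0 i ⟩
  mulVar i (mulVar i (replicate 4 0)) ∎)
  where open ≡-Reasoning

twoVars∉large : ∀ {J} → IndependentSet 4 2 J → length (pureVertices 1) ≤ length J →
  ∀ {i j} → i ≢ j → ∀ {p} → (mulVar i (mulVar j (replicate 4 0)) , p) ∉ J
twoVars∉large {J} ind large {i} {j} i≢j {p} f∈ = adjacentTo (squareVar∈large ind large i)
  where
  xᵢ²xⱼ : mulVar i (mulVar i (mulVar j (replicate 4 0))) ≡ mulVar j (mulVar i (mulVar i (replicate 4 0)))
  xᵢ²xⱼ = trans (cong (mulVar i) (mulVar-comm i j _)) (mulVar-comm i j _)
  adjacentTo : ∃[ g ] g ∈ J × proj₁ g ≡ mulVar i (mulVar i (replicate 4 0)) → ⊥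
  adjacentTo (g , g∈ , refl) = proj₂ ind f∈ g∈ (trans (mulVar-adjacent i≢j xᵢ²xⱼ) (cong suc p))

3≢double : ∀ k → 3 ≢ double k
3≢double zero          ()
3≢double (suc zero)    ()
3≢double (suc (suc k)) ()

largeSetsArePure-step : ∀ k → LargeSetsArePure k → ∀ {J} → IndependentSet 4 (double (suc k)) J →
  length (pureVertices (suc k)) ≤ length J → ∀ x p → (x , p) ∈ J → SameParity x
largeSetsArePure-step k IH ind large (_ ∷ _ ∷ _ ∷ suc (suc _) ∷ []) _ f∈ = high-sameParity k IH ind large f∈ λ { (s≤s ()) }
largeSetsArePure-step k IH ind large (suc (suc _) ∷ _ ∷ _ ∷ _ ∷ []) _ f∈ = swapped-sameParity k IH ind large (# 0) f∈ λ { (s≤s ()) }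
largeSetsArePure-step k IH ind large (_ ∷ suc (suc _) ∷ _ ∷ _ ∷ []) _ f∈ = swapped-sameParity k IH ind large (# 1) f∈ λ { (s≤s ()) }
largeSetsArePure-step k IH ind large (_ ∷ _ ∷ suc (suc _) ∷ _ ∷ []) _ f∈ = swapped-sameParity k IH ind large (# 2) f∈ λ { (s≤s ()) }
largeSetsArePure-step k _ _ _ (1 ∷ 1 ∷ 1 ∷ 1 ∷ []) _ _ = 1ℙ , refl ∷ refl ∷ refl ∷ refl ∷ []
largeSetsArePure-step zero _ ind large (1 ∷ 1 ∷ 0 ∷ 0 ∷ []) _ f∈ = ⊥-elim (twoVars∉large ind large {# 0} {# 1} (λ ()) f∈)
largeSetsArePure-step zero _ ind large (1 ∷ 0 ∷ 1 ∷ 0 ∷ []) _ f∈ = ⊥-elim (twoVars∉large ind large {# 0} {# 2} (λ ()) f∈)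
largeSetsArePure-step zero _ ind large (1 ∷ 0 ∷ 0 ∷ 1 ∷ []) _ f∈ = ⊥-elim (twoVars∉large ind large {# 0} {# 3} (λ ()) f∈)
largeSetsArePure-step zero _ ind large (0 ∷ 1 ∷ 1 ∷ 0 ∷ []) _ f∈ = ⊥-elim (twoVars∉large ind large {# 1} {# 2} (λ ()) f∈)
largeSetsArePure-step zero _ ind large (0 ∷ 1 ∷ 0 ∷ 1 ∷ []) _ f∈ = ⊥-elim (twoVars∉large ind large {# 1} {# 3} (λ ()) f∈)
largeSetsArePure-step zero _ ind large (0 ∷ 0 ∷ 1 ∷ 1 ∷ []) _ f∈ = ⊥-elim (twoVars∉large ind large {# 2} {# 3} (λ ()) f∈)
largeSetsArePure-step (suc _) _ _ _ (1 ∷ 1 ∷ 0 ∷ 0 ∷ []) () _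
largeSetsArePure-step (suc _) _ _ _ (1 ∷ 0 ∷ 1 ∷ 0 ∷ []) () _
largeSetsArePure-step (suc _) _ _ _ (1 ∷ 0 ∷ 0 ∷ 1 ∷ []) () _
largeSetsArePure-step (suc _) _ _ _ (0 ∷ 1 ∷ 1 ∷ 0 ∷ []) () _
largeSetsArePure-step (suc _) _ _ _ (0 ∷ 1 ∷ 0 ∷ 1 ∷ []) () _
largeSetsArePure-step (suc _) _ _ _ (0 ∷ 0 ∷ 1 ∷ 1 ∷ []) () _
largeSetsArePure-step k _ _ _ (0 ∷ 1 ∷ 1 ∷ 1 ∷ []) p _ = ⊥-elim (3≢double (suc k) p)
largeSetsArePure-step k _ _ _ (1 ∷ 0 ∷ 1 ∷ 1 ∷ []) p _ = ⊥-elim (3≢double (suc k) p)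
largeSetsArePure-step k _ _ _ (1 ∷ 1 ∷ 0 ∷ 1 ∷ []) p _ = ⊥-elim (3≢double (suc k) p)
largeSetsArePure-step k _ _ _ (1 ∷ 1 ∷ 1 ∷ 0 ∷ []) p _ = ⊥-elim (3≢double (suc k) p)
largeSetsArePure-step k _ _ _ (1 ∷ 0 ∷ 0 ∷ 0 ∷ []) () _
largeSetsArePure-step k _ _ _ (0 ∷ 1 ∷ 0 ∷ 0 ∷ []) () _
largeSetsArePure-step k _ _ _ (0 ∷ 0 ∷ 1 ∷ 0 ∷ []) () _
largeSetsArePure-step k _ _ _ (0 ∷ 0 ∷ 0 ∷ 1 ∷ []) () _
largeSetsArePure-step k _ _ _ (0 ∷ 0 ∷ 0 ∷ 0 ∷ []) () _

largeSetsArePure : ∀ k → LargeSetsArePure k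
largeSetsArePure zero    _   _     {x , p} _  = subst SameParity (sym (deg≡0⇒≡0⃗ x p)) (0ℙ , refl ∷ refl ∷ refl ∷ refl ∷ [])
largeSetsArePure (suc k) ind large {x , p} f∈ = largeSetsArePure-step k (largeSetsArePure k) ind large x p f∈

theorem3p1 : (k : ℕ) → (d : ℕ) → d ≡ 2 * k →
    Σ (List (S 4 d)) (λ I → MaximumIndependentSet 4 d I ×
      (∀ (J : List (S 4 d)) → MaximumIndependentSet 4 d J → SameSet J I))
theorem3p1 k d refl rewrite 2*n≡double k =
  pureVertices k , uniqueMaximum (pureVertices-independent k) (λ _ → independent⇒length≤ k)
    (λ _ ind large f∈ → ∈-pureVertices (largeSetsArePure k ind large f∈))
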